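{- Let $\phi$ be a $\mathbf{Gr}(\mathbf{K}_\mathcal{R})$-formula in negation normal form. If there is a sequence of applications of the optimised rules starting with $\{x_0\models\phi\}$ that results in a complete and clash-free constraint system, then $\phi$ is satisfiable.
   Context: Formulae in NNF: $p$, $\neg p$, $\psi_1\wedge\psi_2$, $\psi_1\vee\psi_2$, $\langle R\rangle_{\ge n}\psi$, $\langle R\rangle_{\le n}\psi$ (at least / at most $n$ $R$-successors satisfy $\psi$). $\sim\psi$ is the NNF of $\neg\psi$ (De Morgan, $\neg\langle R\rangle_{\ge 0}\psi\equiv p\wedge\neg p$, $\neg\langle R\rangle_{\ge n}\psi\equiv\langle R\rangle_{\le n-1}\psi$ for $n\ge1$, $\neg\langle R\rangle_{\le n}\psi\equiv\langle R\rangle_{\ge n+1}\psi$). A constraint system (c.s.) is a finite set of expressions $x\models\psi$ and $Rxy$ over variables; $\sharp R^S(x,\psi)=|\{y:\{Rxy,y\models\psi\}\subseteq S\}|$. Optimised rules: ($\wedge$) if $x\models\psi_1\wedge\psi_2\in S$ and not both $x\models\psi_1,x\models\psi_2\in S$, add both; ($\vee$) if $x\models\psi_1\vee\psi_2\in S$ and neither disjunct constraint is in $S$, add $x\models\chi$ for a chosen $\chi\in\{\psi_1,\psi_2\}$; ($\ge$) if $x\models\langle R\rangle_{\ge n}\psi\in S$, $\sharp R^S(x,\psi)<n$, and neither the $\wedge$- nor $\vee$-rule applies to a constraint for $x$, add $Rxy$, $y\models\psi$, $y\models\chi_1,\dots,y\models\chi_k$ for a fresh $y$, where $\{\psi_1,\dots,\psi_k\}=\{\psi':x\models\langle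 R\rangle_{\bowtie m}\psi'\in S,\ \bowtie\in\{\le,\ge\}\}$ and each $\chi_i\in\{\psi_i,\sim\psi_i\}$ chosen nondeterministically. A c.s. is complete if no rule applies. It contains a clash if $\{x\models p,x\models\neg p\}\subseteq S$ for some $x$ and atom $p$, or $x\models\langle R\rangle_{\le n}\psi\in S$ and $\sharp R^S(x,\psi)>n$; otherwise it is clash-free. -}

module Defs where

open import Data.Nat using (ℕ; zero; suc)
open import Data.List using (List; []; _∷_; length; map; _++_)
open import Data.List.Membership.Propositional using (_∈_)
open import Data.List.Relation.Unary.All using (All)
open import Data.List.Relation.Unary.Any using (Any)
open import Data.List.Relation.Unary.Unique.Propositional using (Unique)
open import Data.List.Relation.Binary.Pointwise using (Pointwise)
open import Data.Product using (Σ; _×_)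
open import Data.Sum using (_⊎_)
open import Relation.Nullary using (¬_)
open import Relation.Binary.PropositionalEquality using (_≡_)
open import Relation.Binary.Construct.Closure.ReflexiveTransitive using (Star)

data Fm : Set where
  atom  : ℕ → Fm
  natom : ℕ → Fm
  and   : Fm → Fm → Fm
  or    : Fm → Fm → Fm
  geq   : ℕ → ℕ → Fm → Fm        -- geq R n ψ  =  ⟨R⟩_{≥ n} ψ
  leq   : ℕ → ℕ → Fm → Fm        -- leq R n ψ  =  ⟨R⟩_{≤ n} ψ

-- ∼ψ : the NNF of ¬ψ.  (p ∧ ¬p is instantiated with atom 0.)
∼_ : Fm → Fm
∼ atom p = natom p
∼ natom p = atom p
∼ and a b = or (∼ a) (∼ b)
∼ or a b = and (∼ a) (∼ b)
∼ geq R zero ψ = and (atom 0) (natom 0)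
∼ geq R (suc n) ψ = leq R n ψ
∼ leq R n ψ = geq R (suc n) ψ

record Model : Set₁ where
  field
    W   : Set
    Acc : ℕ → W → W → Set     -- Acc R w v : v is an R-successor of w
    V   : ℕ → W → Set

open Model

AtLeastSem : (M : Model) → ℕ → W M → (W M → Set) → ℕ → Set
AtLeastSem M R w P n =
  Σ (List (W M)) λ vs → length vs ≡ n × Unique vs × All (λ v → Acc M R w v × P v) vs

Sat : (M : Model) → W M → Fm → Set
Sat M w (atom p) = V M p w
Sat M w (natom p) = ¬ V M p w
Sat M w (and a b) = Sat M w a × Sat M w b
Sat M w (or a b) = Sat M w a ⊎ Sat M w b
Sat M w (geq R n ψ) = AtLeastSem M R w (λ v → Sat M v ψ) n
Sat M w (leq R n ψ) = ¬ AtLeastSem M R w (λ v → Sat M v ψ) (suc n)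

Satisfiable : Fm → Set₁
Satisfiable φ = Σ Model λ M → Σ (W M) λ w → Sat M w φ

-- Constraint systems (variables are natural numbers; x₀ = 0).

data Con : Set where
  _⊨_ : ℕ → Fm → Con
  rel : ℕ → ℕ → ℕ → Con         -- rel R x y  =  R x y

CS : Set
CS = List Con

AtLeast : CS → ℕ → ℕ → Fm → ℕ → Set
AtLeast S R x ψ n =
  Σ (List ℕ) λ ys → length ys ≡ n × Unique ys × All (λ y → rel R x y ∈ S × (y ⊨ ψ) ∈ S) ys

Mentions : ℕ → Con → Set
Mentions y (x ⊨ ψ) = x ≡ y
Mentions y (rel R a b) = a ≡ y ⊎ b ≡ y

Occurs : ℕ → CS → Set
Occurs y S = Any (Mentions y) S

AndApplies : CS → ℕ → Set
AndApplies S x = Σ Fm λ a → Σ Fm λ b →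
  (x ⊨ and a b) ∈ S × ¬ ((x ⊨ a) ∈ S × (x ⊨ b) ∈ S)

OrApplies : CS → ℕ → Set
OrApplies S x = Σ Fm λ a → Σ Fm λ b →
  (x ⊨ or a b) ∈ S × ¬ ((x ⊨ a) ∈ S) × ¬ ((x ⊨ b) ∈ S)

Graded : CS → ℕ → ℕ → Fm → Set
Graded S x R ψ' = Σ ℕ λ m → (x ⊨ geq R m ψ') ∈ S ⊎ (x ⊨ leq R m ψ') ∈ S

data _⟶_ : CS → CS → Set where
  ∧-rule : ∀ {S x a b} →
    (x ⊨ and a b) ∈ S → ¬ ((x ⊨ a) ∈ S × (x ⊨ b) ∈ S) →
    S ⟶ ((x ⊨ a) ∷ (x ⊨ b) ∷ S)
  ∨-rule : ∀ {S x a b χ} →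
    (x ⊨ or a b) ∈ S → ¬ ((x ⊨ a) ∈ S) → ¬ ((x ⊨ b) ∈ S) →
    (χ ≡ a ⊎ χ ≡ b) →
    S ⟶ ((x ⊨ χ) ∷ S)
  ≥-rule : ∀ {S x R n ψ y} (ψs χs : List Fm) →
    (x ⊨ geq R n ψ) ∈ S → ¬ AtLeast S R x ψ n →
    ¬ AndApplies S x → ¬ OrApplies S x →
    ¬ Occurs y S →
    Unique ψs →
    (∀ ψ' → (ψ' ∈ ψs → Graded S x R ψ') × (Graded S x R ψ' → ψ' ∈ ψs)) →
    Pointwise (λ ψi χi → χi ≡ ψi ⊎ χi ≡ ∼ ψi) ψs χs →
    S ⟶ (rel R x y ∷ (y ⊨ ψ) ∷ (map (y ⊨_) χs ++ S))

_⟶*_ : CS → CS → Set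
_⟶*_ = Star _⟶_

Complete : CS → Set
Complete S = ∀ S' → ¬ (S ⟶ S')

Clash : CS → Set
Clash S =
  (Σ ℕ λ x → Σ ℕ λ p → (x ⊨ atom p) ∈ S × (x ⊨ natom p) ∈ S)
  ⊎ (Σ ℕ λ x → Σ ℕ λ R → Σ ℕ λ n → Σ Fm λ ψ →
       (x ⊨ leq R n ψ) ∈ S × AtLeast S R x ψ (suc n))

ClashFree : CS → Set
ClashFree S = ¬ Clash S

-- The canonical model of a complete clash-free system S has the variables as worlds, the
-- R-edges of S as R-accessibility, and p true at x iff x ⊨ p ∈ S; by induction on ψ, run
-- simultaneously for ∼ψ, every constraint x ⊨ ψ of S holds there.  The delicate case is
-- ⟨R⟩≤n ψ: every R-successor y of x satisfying ψ must carry y ⊨ ψ, so that too many of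
-- them would be a clash.  This holds because the ≥-rule fires only at ∧∨-saturated
-- variables, which never gain constraints afterwards, and labels each new successor with
-- ψ′ or ∼ψ′ for every graded ψ′ of its parent; so y carries ψ or ∼ψ, and ∼ψ is ruled out
-- by induction.

module Submission where

open import Defs
open import Data.Nat using (ℕ; zero; suc; _≤_; _≤?_; z≤n; s≤s)
open import Data.Nat.Properties using (_≟_; 1+n≰n; m≤n⇒m⊓n≡m)
open import Data.List using (List; []; _∷_; length; map; take; removeAt; filter; deduplicate)
open import Data.List.Properties using (length-take; length-removeAt′)
open import Data.List.Extrema.Nat using (max; xs≤max)
open import Data.List.Membership.Propositional using (_∈_; lose)
open import Data.List.Membership.Propositional.Properties
  using (∈-++⁺ˡ; ∈-++⁺ʳ; ∈-++⁻; ∈-map⁺; ∈-map⁻; ∈-filter⁺; ∈-filter⁻; ∈-deduplicate⁺; ∈-deduplicate⁻)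
open import Data.List.Relation.Binary.Subset.Propositional using (_⊆_)
open import Data.List.Relation.Unary.All as All using (All)
import Data.List.Relation.Unary.All.Properties as All
open import Data.List.Relation.Unary.Any using (Any; here; there; index; any?)
open import Data.List.Relation.Unary.AllPairs using (_∷_)
open import Data.List.Relation.Unary.Unique.Propositional using (Unique)
import Data.List.Relation.Unary.Unique.Propositional.Properties as Unique
import Data.List.Relation.Unary.Unique.DecPropositional.Properties as DecUnique
open import Data.List.Relation.Binary.Pointwise using (Pointwise; _∷_)
import Data.List.Relation.Binary.Pointwise.Properties as Pointwise
open import Data.Product as Product using (Σ; ∃; _×_; _,_; proj₁; proj₂)
open import Data.Sum as Sum using (_⊎_; inj₁; inj₂)
open import Data.Empty using (⊥-elim)
open import Function using (_∘_; id)
open import Relation.Nullary using (¬_; Dec; yes; no)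
open import Relation.Nullary.Decidable using (map′; _×-dec_; _⊎-dec_; decidable-stable)
open import Relation.Unary using (Decidable)
open import Relation.Binary.Definitions using (DecidableEquality)
open import Relation.Binary.PropositionalEquality using (_≡_; _≢_; refl; cong; subst; sym; trans)
open import Relation.Binary.Construct.Closure.ReflexiveTransitive as Star using (Star)

tag : Fm → ℕ
tag (atom _) = 0
tag (natom _) = 1
tag (and _ _) = 2
tag (or _ _) = 3
tag (geq _ _ _) = 4
tag (leq _ _ _) = 5

_≟F_ : DecidableEquality Fm
-- No clauses are needed for distinct constructors: their tag equation is absurd.
≟-sameTag : ∀ φ ψ → tag φ ≡ tag ψ → Dec (φ ≡ ψ)

φ ≟F ψ with tag φ ≟ tag ψ
... | yes same = ≟-sameTag φ ψ same
... | no differ = no (differ ∘ cong tag)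

≟-sameTag (atom p) (atom q) _ = map′ (cong atom) (λ { refl → refl }) (p ≟ q)
≟-sameTag (natom p) (natom q) _ = map′ (cong natom) (λ { refl → refl }) (p ≟ q)
≟-sameTag (and φ₁ φ₂) (and ψ₁ ψ₂) _ =
  map′ (λ { (refl , refl) → refl }) (λ { refl → refl , refl }) (φ₁ ≟F ψ₁ ×-dec φ₂ ≟F ψ₂)
≟-sameTag (or φ₁ φ₂) (or ψ₁ ψ₂) _ =
  map′ (λ { (refl , refl) → refl }) (λ { refl → refl , refl }) (φ₁ ≟F ψ₁ ×-dec φ₂ ≟F ψ₂)
≟-sameTag (geq R m φ) (geq R′ n ψ) _ =
  map′ (λ { (refl , refl , refl) → refl }) (λ { refl → refl , refl , refl })
       (R ≟ R′ ×-dec m ≟ n ×-dec φ ≟F ψ)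
≟-sameTag (leq R m φ) (leq R′ n ψ) _ =
  map′ (λ { (refl , refl , refl) → refl }) (λ { refl → refl , refl , refl })
       (R ≟ R′ ×-dec m ≟ n ×-dec φ ≟F ψ)

_≟C_ : DecidableEquality Con
(x ⊨ φ) ≟C (y ⊨ ψ) =
  map′ (λ { (refl , refl) → refl }) (λ { refl → refl , refl }) (x ≟ y ×-dec φ ≟F ψ)
rel R x y ≟C rel R′ x′ y′ =
  map′ (λ { (refl , refl , refl) → refl }) (λ { refl → refl , refl , refl })
       (R ≟ R′ ×-dec x ≟ x′ ×-dec y ≟ y′)
(_ ⊨ _) ≟C rel _ _ _ = no λ ()
rel _ _ _ ≟C (_ ⊨ _) = no λ ()

open import Data.List.Membership.DecPropositional _≟C_ using (_∈?_)

Witnesses : {A : Set} → (A → Set) → ℕ → Set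
Witnesses {A} P n = Σ (List A) λ ys → length ys ≡ n × Unique ys × All P ys

module _ {A : Set} where

  ∈-removeAt : ∀ {x z : A} {ys} (x∈ys : x ∈ ys) → z ∈ ys → x ≢ z → z ∈ removeAt ys (index x∈ys)
  ∈-removeAt (here refl) (here refl) x≢z = ⊥-elim (x≢z refl)
  ∈-removeAt (here _) (there z∈ys) _ = z∈ys
  ∈-removeAt (there _) (here refl) _ = here refl
  ∈-removeAt (there x∈ys) (there z∈ys) x≢z = there (∈-removeAt x∈ys z∈ys x≢z)

  unique⊆⇒length≤ : ∀ {xs ys : List A} → Unique xs → xs ⊆ ys → length xs ≤ length ys
  unique⊆⇒length≤ {[]} _ _ = z≤n
  unique⊆⇒length≤ {x ∷ xs} {ys} (x∉xs ∷ xs-unique) xs⊆ys =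
    subst (suc (length xs) ≤_) (sym (length-removeAt′ ys (index x∈ys)))
      (s≤s (unique⊆⇒length≤ xs-unique λ z∈xs →
              ∈-removeAt x∈ys (xs⊆ys (there z∈xs)) (All.lookup x∉xs z∈xs)))
    where x∈ys = xs⊆ys (here refl)

  Pointwise-∈ : ∀ {B : Set} {_∼_ : A → B → Set} {xs ys x} →
                Pointwise _∼_ xs ys → x ∈ xs → ∃ λ y → y ∈ ys × x ∼ y
  Pointwise-∈ (x∼y ∷ _) (here refl) = _ , here refl , x∼y
  Pointwise-∈ (_ ∷ xs∼ys) (there x∈xs) = Product.map₂ (Product.map₁ there) (Pointwise-∈ xs∼ys x∈xs)

  Star-preserves : ∀ {T : A → A → Set} (I : A → Set) → (∀ {a b} → T a b → I a → I b) →
                   ∀ {a b} → Star T a b → I a → I b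
  Star-preserves I step = Star.fold (λ a b → I a → I b) (λ t k → k ∘ step t) id

module _ {A : Set} (_≟_ : DecidableEquality A) {P : A → Set} (P? : Decidable P) where

  enumerate : List A → List A
  enumerate vs = deduplicate _≟_ (filter P? vs)

  enumerate-unique : ∀ vs → Unique (enumerate vs)
  enumerate-unique vs = DecUnique.deduplicate-! _≟_ (filter P? vs)

  ∈-enumerate⁻ : ∀ vs {y} → y ∈ enumerate vs → P y
  ∈-enumerate⁻ vs y∈ws = proj₂ (∈-filter⁻ P? {xs = vs} (∈-deduplicate⁻ _≟_ (filter P? vs) y∈ws))

  ∈-enumerate⁺ : ∀ {vs y} → y ∈ vs → P y → y ∈ enumerate vs
  ∈-enumerate⁺ y∈vs Py = ∈-deduplicate⁺ _≟_ (∈-filter⁺ P? y∈vs Py)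

  witnesses⇒≤ : ∀ {vs n} → (∀ {y} → P y → y ∈ vs) → Witnesses P n → n ≤ length (enumerate vs)
  witnesses⇒≤ P⊆vs (ys , refl , ys-unique , P-ys) = unique⊆⇒length≤ ys-unique λ y∈ys →
    let Py = All.lookup P-ys y∈ys in ∈-enumerate⁺ (P⊆vs Py) Py

  ≤⇒witnesses : ∀ vs {n} → n ≤ length (enumerate vs) → Witnesses P n
  ≤⇒witnesses vs {n} n≤ =
    take n ws , trans (length-take n ws) (m≤n⇒m⊓n≡m n≤) ,
    Unique.take⁺ n (enumerate-unique vs) , All.take⁺ n (All.tabulate (∈-enumerate⁻ vs))
    where ws = enumerate vs

  witnesses? : ∀ vs → (∀ {y} → P y → y ∈ vs) → ∀ n → Dec (Witnesses P n)
  witnesses? vs P⊆vs n = map′ (≤⇒witnesses vs) (witnesses⇒≤ P⊆vs) (n ≤? length (enumerate vs))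

sat-∼⇒¬sat : ∀ M w ψ → Sat M w (∼ ψ) → ¬ Sat M w ψ
sat-∼⇒¬sat M w (atom _) ¬v v = ¬v v
sat-∼⇒¬sat M w (natom _) v ¬v = ¬v v
sat-∼⇒¬sat M w (and a b) (inj₁ ∼a) (sa , _) = sat-∼⇒¬sat M w a ∼a sa
sat-∼⇒¬sat M w (and a b) (inj₂ ∼b) (_ , sb) = sat-∼⇒¬sat M w b ∼b sb
sat-∼⇒¬sat M w (or a b) (∼a , _) (inj₁ sa) = sat-∼⇒¬sat M w a ∼a sa
sat-∼⇒¬sat M w (or a b) (_ , ∼b) (inj₂ sb) = sat-∼⇒¬sat M w b ∼b sb
sat-∼⇒¬sat M w (geq R zero ψ) (v , ¬v) _ = ¬v v
sat-∼⇒¬sat M w (geq R (suc n) ψ) few many = few many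
sat-∼⇒¬sat M w (leq R n ψ) many few = few many

variables : CS → List ℕ
variables [] = []
variables ((x ⊨ _) ∷ S) = x ∷ variables S
variables (rel _ x y ∷ S) = x ∷ y ∷ variables S

occurs⇒∈variables : ∀ {y} S → Occurs y S → y ∈ variables S
occurs⇒∈variables ((_ ⊨ _) ∷ S) (here refl) = here refl
occurs⇒∈variables ((_ ⊨ _) ∷ S) (there y∈S) = there (occurs⇒∈variables S y∈S)
occurs⇒∈variables (rel _ _ _ ∷ S) (here (inj₁ refl)) = here refl
occurs⇒∈variables (rel _ _ _ ∷ S) (here (inj₂ refl)) = there (here refl)
occurs⇒∈variables (rel _ _ _ ∷ S) (there y∈S) = there (there (occurs⇒∈variables S y∈S))

fresh : CS → ℕ
fresh S = suc (max 0 (variables S))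

fresh-∉ : ∀ S → ¬ Occurs (fresh S) S
fresh-∉ S occurs = 1+n≰n (All.lookup (xs≤max 0 (variables S)) (occurs⇒∈variables S occurs))

atLeast? : ∀ S R x ψ n → Dec (AtLeast S R x ψ n)
atLeast? S R x ψ =
  witnesses? _≟_ P? (variables S) (λ (e , _) → occurs⇒∈variables S (lose e (inj₂ refl)))
  where
  P? : Decidable (λ y → rel R x y ∈ S × (y ⊨ ψ) ∈ S)
  P? y = rel R x y ∈? S ×-dec (y ⊨ ψ) ∈? S

data GradedAt (x R : ℕ) (ψ : Fm) : Con → Set where
  ≥-graded : ∀ m → GradedAt x R ψ (x ⊨ geq R m ψ)
  ≤-graded : ∀ m → GradedAt x R ψ (x ⊨ leq R m ψ)

gradedAt? : ∀ x R ψ → Decidable (GradedAt x R ψ)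
gradedAt? x R ψ (z ⊨ geq R′ m φ) =
  map′ (λ { (refl , refl , refl) → ≥-graded m }) (λ { (≥-graded _) → refl , refl , refl })
       (z ≟ x ×-dec R′ ≟ R ×-dec φ ≟F ψ)
gradedAt? x R ψ (z ⊨ leq R′ m φ) =
  map′ (λ { (refl , refl , refl) → ≤-graded m }) (λ { (≤-graded _) → refl , refl , refl })
       (z ≟ x ×-dec R′ ≟ R ×-dec φ ≟F ψ)
gradedAt? x R ψ (_ ⊨ atom _) = no λ ()
gradedAt? x R ψ (_ ⊨ natom _) = no λ ()
gradedAt? x R ψ (_ ⊨ and _ _) = no λ ()
gradedAt? x R ψ (_ ⊨ or _ _) = no λ ()
gradedAt? x R ψ (rel _ _ _) = no λ ()

graded⇒any : ∀ {S x R ψ} → Graded S x R ψ → Any (GradedAt x R ψ) S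
graded⇒any (m , inj₁ c∈S) = lose c∈S (≥-graded m)
graded⇒any (m , inj₂ c∈S) = lose c∈S (≤-graded m)

any⇒graded : ∀ {S x R ψ} → Any (GradedAt x R ψ) S → Graded S x R ψ
any⇒graded (here (≥-graded m)) = m , inj₁ (here refl)
any⇒graded (here (≤-graded m)) = m , inj₂ (here refl)
any⇒graded (there p) = Product.map₂ (Sum.map there there) (any⇒graded p)

graded? : ∀ S x R → Decidable (Graded S x R)
graded? S x R ψ = map′ any⇒graded graded⇒any (any? (gradedAt? x R ψ) S)

body : Con → Fm
body (_ ⊨ geq _ _ ψ) = ψ
body (_ ⊨ leq _ _ ψ) = ψ
body _ = atom 0

gradedFormulas : CS → ℕ → ℕ → List Fm
gradedFormulas S x R = enumerate _≟F_ (graded? S x R) (map body S)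

gradedFormulas-unique : ∀ S x R → Unique (gradedFormulas S x R)
gradedFormulas-unique S x R = enumerate-unique _≟F_ (graded? S x R) (map body S)

∈-gradedFormulas : ∀ S x R ψ →
  (ψ ∈ gradedFormulas S x R → Graded S x R ψ) × (Graded S x R ψ → ψ ∈ gradedFormulas S x R)
∈-gradedFormulas S x R ψ =
  ∈-enumerate⁻ _≟F_ (graded? S x R) (map body S) ,
  λ g → ∈-enumerate⁺ _≟F_ (graded? S x R) (∈-bodies g) g
  where
  ∈-bodies : Graded S x R ψ → ψ ∈ map body S
  ∈-bodies (_ , inj₁ c∈S) = ∈-map⁺ body c∈S
  ∈-bodies (_ , inj₂ c∈S) = ∈-map⁺ body c∈S

Saturated : CS → ℕ → Set
Saturated S x = ¬ AndApplies S x × ¬ OrApplies S x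

Decides : CS → ℕ → Fm → Set
Decides S y ψ = (y ⊨ ψ) ∈ S ⊎ (y ⊨ (∼ ψ)) ∈ S

DecidedEdge : CS → ℕ → ℕ → ℕ → Set
DecidedEdge S R x y = Saturated S x × (∀ ψ → Graded S x R ψ → Decides S y ψ)

EdgesDecided : CS → Set
EdgesDecided S = ∀ {R x y} → rel R x y ∈ S → DecidedEdge S R x y

Frozen : ℕ → CS → CS → Set
Frozen x S S′ = ∀ {φ} → (x ⊨ φ) ∈ S′ → (x ⊨ φ) ∈ S

saturated-frozen : ∀ {S S′ x} → S ⊆ S′ → Frozen x S S′ → Saturated S x → Saturated S′ x
saturated-frozen S⊆S′ frozen (¬and , ¬or) =
  (λ (a , b , ab∈S′ , ¬both) → ¬and (a , b , frozen ab∈S′ , ¬both ∘ Product.map S⊆S′ S⊆S′)) ,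
  (λ (a , b , ab∈S′ , ¬a , ¬b) → ¬or (a , b , frozen ab∈S′ , ¬a ∘ S⊆S′ , ¬b ∘ S⊆S′))

graded-frozen : ∀ {S S′ x R ψ} → Frozen x S S′ → Graded S′ x R ψ → Graded S x R ψ
graded-frozen frozen = Product.map₂ (Sum.map frozen frozen)

rel∉map⊨ : ∀ {R x y z χs} → ¬ rel R x y ∈ map (z ⊨_) χs
rel∉map⊨ {χs = _ ∷ χs} (there r∈) = rel∉map⊨ {χs = χs} r∈

⟶-⊆ : ∀ {S S′} → S ⟶ S′ → S ⊆ S′
⟶-⊆ (∧-rule _ _) = there ∘ there
⟶-⊆ (∨-rule _ _ _ _) = there
⟶-⊆ (≥-rule _ χs _ _ _ _ _ _ _ _) = there ∘ there ∘ ∈-++⁺ʳ (map _ χs)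

⟶-frozen : ∀ {S S′ x} → S ⟶ S′ → Occurs x S → Saturated S x → Frozen x S S′
⟶-frozen (∧-rule ab∈S ¬both) _ (¬and , _) (here refl) = ⊥-elim (¬and (_ , _ , ab∈S , ¬both))
⟶-frozen (∧-rule ab∈S ¬both) _ (¬and , _) (there (here refl)) = ⊥-elim (¬and (_ , _ , ab∈S , ¬both))
⟶-frozen (∧-rule _ _) _ _ (there (there φ∈S)) = φ∈S
⟶-frozen (∨-rule ab∈S ¬a ¬b _) _ (_ , ¬or) (here refl) = ⊥-elim (¬or (_ , _ , ab∈S , ¬a , ¬b))
⟶-frozen (∨-rule _ _ _ _) _ _ (there φ∈S) = φ∈S
⟶-frozen (≥-rule _ _ _ _ _ _ y-fresh _ _ _) x-occurs _ (there (here refl)) = ⊥-elim (y-fresh x-occurs)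
⟶-frozen (≥-rule _ χs _ _ _ _ y-fresh _ _ _) x-occurs _ (there (there φ∈)) with ∈-++⁻ (map _ χs) φ∈
... | inj₂ φ∈S = φ∈S
... | inj₁ φ∈χs with ∈-map⁻ _ φ∈χs
...   | _ , _ , refl = ⊥-elim (y-fresh x-occurs)

decided-edge-⟶ : ∀ {S S′ R x y} →
                 S ⟶ S′ → rel R x y ∈ S → DecidedEdge S R x y → DecidedEdge S′ R x y
decided-edge-⟶ step e (saturated , decides) =
  saturated-frozen (⟶-⊆ step) frozen saturated ,
  λ ψ graded → Sum.map (⟶-⊆ step) (⟶-⊆ step) (decides ψ (graded-frozen frozen graded))
  where frozen = ⟶-frozen step (lose e (inj₁ refl)) saturated

edges-decided-⟶ : ∀ {S S′} → S ⟶ S′ → EdgesDecided S → EdgesDecided S′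
edges-decided-⟶ step@(∧-rule _ _) edges (there (there e)) = decided-edge-⟶ step e (edges e)
edges-decided-⟶ step@(∨-rule _ _ _ _) edges (there e) = decided-edge-⟶ step e (edges e)
edges-decided-⟶ step@(≥-rule _ χs _ _ _ _ _ _ _ _) edges (there (there e)) with ∈-++⁻ (map _ χs) e
... | inj₁ e∈χs = ⊥-elim (rel∉map⊨ {χs = χs} e∈χs)
... | inj₂ e∈S = decided-edge-⟶ step e∈S (edges e∈S)
edges-decided-⟶ step@(≥-rule {y = y} ψs χs geq∈S _ ¬and ¬or _ _ enumerates choice) _ (here refl) =
  saturated-frozen (⟶-⊆ step) frozen (¬and , ¬or) ,
  λ ψ graded → chosen (Pointwise-∈ choice (proj₂ (enumerates ψ) (graded-frozen frozen graded)))
  where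
  frozen = ⟶-frozen step (lose geq∈S refl) (¬and , ¬or)
  chosen : ∀ {ψ} → ∃ (λ χ → χ ∈ χs × (χ ≡ ψ ⊎ χ ≡ ∼ ψ)) → Decides _ y ψ
  chosen (_ , χ∈χs , inj₁ refl) = inj₁ (there (there (∈-++⁺ˡ (∈-map⁺ (y ⊨_) χ∈χs))))
  chosen (_ , χ∈χs , inj₂ refl) = inj₂ (there (there (∈-++⁺ˡ (∈-map⁺ (y ⊨_) χ∈χs))))

module _ {S : CS} (complete : Complete S) where

  complete-∧ : ∀ {x a b} → (x ⊨ and a b) ∈ S → (x ⊨ a) ∈ S × (x ⊨ b) ∈ S
  complete-∧ ab∈S = decidable-stable (_ ∈? S ×-dec _ ∈? S) λ ¬both → complete _ (∧-rule ab∈S ¬both)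

  complete-∨ : ∀ {x a b} → (x ⊨ or a b) ∈ S → (x ⊨ a) ∈ S ⊎ (x ⊨ b) ∈ S
  complete-∨ ab∈S = decidable-stable (_ ∈? S ⊎-dec _ ∈? S) λ ¬either →
    complete _ (∨-rule ab∈S (¬either ∘ inj₁) (¬either ∘ inj₂) (inj₁ refl))

  complete⇒saturated : ∀ {x} → Saturated S x
  complete⇒saturated = (λ (_ , _ , ab∈S , ¬both) → ¬both (complete-∧ ab∈S)) ,
                       (λ (_ , _ , ab∈S , ¬a , ¬b) → Sum.[ ¬a , ¬b ] (complete-∨ ab∈S))

  complete-≥ : ∀ {x R n ψ} → (x ⊨ geq R n ψ) ∈ S → AtLeast S R x ψ n
  complete-≥ {x} {R} {n} {ψ} geq∈S = decidable-stable (atLeast? S R x ψ n) λ ¬enough →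
    complete _ (≥-rule ψs ψs geq∈S ¬enough (proj₁ complete⇒saturated) (proj₂ complete⇒saturated)
                       (fresh-∉ S) (gradedFormulas-unique S x R)
                       (∈-gradedFormulas S x R) (Pointwise.refl (inj₁ refl)))
    where ψs = gradedFormulas S x R

canonical : CS → Model
canonical S = record { W = ℕ ; Acc = λ R x y → rel R x y ∈ S ; V = λ p x → (x ⊨ atom p) ∈ S }

module Truth {S : CS} (complete : Complete S) (clash-free : ClashFree S) (edges : EdgesDecided S) where

  Holds : Fm → Set
  Holds ψ = ∀ {y} → (y ⊨ ψ) ∈ S → Sat (canonical S) y ψ

  truth-geq : ∀ {R n ψ} → Holds ψ → Holds (geq R n ψ)
  truth-geq holds geq∈S =
    let ys , |ys| , ys-unique , succ-ψ = complete-≥ complete geq∈S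
    in ys , |ys| , ys-unique , All.map (Product.map₂ holds) succ-ψ

  truth-leq : ∀ {R n ψ} → Holds ψ → Holds (∼ ψ) → Holds (leq R n ψ)
  truth-leq {R} {n} {ψ} holds holds∼ {x} leq∈S (vs , |vs| , vs-unique , succ-ψ) =
    clash-free (inj₂ (x , R , n , ψ , leq∈S , vs , |vs| , vs-unique , All.map labelled succ-ψ))
    where
    labelled : ∀ {v} → rel R x v ∈ S × Sat (canonical S) v ψ → rel R x v ∈ S × (v ⊨ ψ) ∈ S
    labelled (e , sat) with proj₂ (edges e) ψ (n , inj₂ leq∈S)
    ... | inj₁ ψ∈S = e , ψ∈S
    ... | inj₂ ∼ψ∈S = ⊥-elim (sat-∼⇒¬sat (canonical S) _ ψ (holds∼ ∼ψ∈S) sat)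

  truth : ∀ ψ → Holds ψ
  truth-∼ : ∀ ψ → Holds (∼ ψ)

  truth (atom p) p∈S = p∈S
  truth (natom p) ¬p∈S p∈S = clash-free (inj₁ (_ , p , p∈S , ¬p∈S))
  truth (and a b) ab∈S = Product.map (truth a) (truth b) (complete-∧ complete ab∈S)
  truth (or a b) ab∈S = Sum.map (truth a) (truth b) (complete-∨ complete ab∈S)
  truth (geq R n ψ) = truth-geq (truth ψ)
  truth (leq R n ψ) = truth-leq (truth ψ) (truth-∼ ψ)

  truth-∼ (atom p) = truth (natom p)
  truth-∼ (natom p) = truth (atom p)
  truth-∼ (and a b) ab∈S = Sum.map (truth-∼ a) (truth-∼ b) (complete-∨ complete ab∈S)
  truth-∼ (or a b) ab∈S = Product.map (truth-∼ a) (truth-∼ b) (complete-∧ complete ab∈S)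
  truth-∼ (geq R zero ψ) ⊥∈S = ⊥-elim (clash-free (inj₁ (_ , 0 , complete-∧ complete ⊥∈S)))
  truth-∼ (geq R (suc n) ψ) = truth-leq (truth ψ) (truth-∼ ψ)
  truth-∼ (leq R n ψ) = truth-geq (truth ψ)

lemma4 : (φ : Fm) (S : CS) →
    ((0 ⊨ φ) ∷ []) ⟶* S → Complete S → ClashFree S → Satisfiable φ
lemma4 φ S run complete clash-free =
  canonical S , 0 , Truth.truth complete clash-free edges φ φ∈S
  where
  φ∈S : (0 ⊨ φ) ∈ S
  φ∈S = Star-preserves ((0 ⊨ φ) ∈_) (λ step → ⟶-⊆ step) run (here refl)
  edges : EdgesDecided S
  edges = Star-preserves EdgesDecided edges-decided-⟶ run λ { (here ()) ; (there ()) }
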